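{- Let $(L,\leq)$ be a locally finite inf-semilattice with bottom element $\bot$, and let $\widetilde{L}:=\{(x,y)\in L\times L\mid x\wedge y=\bot\}$ with the product order of $L^2$. Then for all $(z,t),(x,y)\in\widetilde{L}$ with $(z,t)\leq(x,y)$, the Möbius function of $\widetilde{L}$ satisfies $\mu_{\widetilde{L}}((z,t),(x,y))=\mu_L(z,x)\,\mu_L(t,y)$, where $\mu_L$ is the Möbius function of $L$.
   Context: For a locally finite poset $(X,\leq)$ with bottom element, the Möbius function $\mu_X:X\times X\to\mathbb{R}$ is the function such that for all real-valued functions $f,g$ on $X$, $g(x)=\sum_{y\leq x}f(y)$ for all $x$ holds if and only if $f(x)=\sum_{y\leq x}\mu_X(y,x)g(y)$ for all $x$. -}

module Defs where

open import Data.Integer using (ℤ; 0ℤ; _+_; _*_)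
open import Data.List using (List; map; foldr)
open import Data.List.Membership.Propositional using (_∈_)
open import Data.List.Relation.Unary.Unique.Propositional using (Unique)
open import Data.Product using (_×_; _,_)
open import Data.Unit using (⊤)
open import Function.Bundles using (_⇔_)
open import Relation.Binary.PropositionalEquality using (_≡_)
open import Relation.Binary.Lattice.Structures using (IsMeetSemilattice)

sumℤ : List ℤ → ℤ
sumℤ = foldr _+_ 0ℤ

record FinDownSets (X : Set) (S : X → Set) (_≤_ : X → X → Set) : Set where
  field
    down        : X → List X
    down-unique : ∀ x → Unique (down x)
    down-spec   : ∀ x → S x → ∀ y → (y ∈ down x) ⇔ (S y × y ≤ x)

-- The Möbius function characterization from the paper (with ℤ-valued
-- functions): for all f g,  g(x) = Σ_{y≤x} f(y) for all x  iff
-- f(x) = Σ_{y≤x} μ(y,x) g(y) for all x  (x ranging over the poset S).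
IsMobius : {X : Set} (S : X → Set) (down : X → List X) (μ : X → X → ℤ) → Set
IsMobius {X} S down μ =
  (f g : X → ℤ) →
  ((∀ x → S x → g x ≡ sumℤ (map f (down x)))
    ⇔ (∀ x → S x → f x ≡ sumℤ (map (λ y → μ y x * g y) (down x))))

record LFMeetSemilatticeWithBot : Set₁ where
  field
    Carrier   : Set
    _≤_       : Carrier → Carrier → Set
    _∧_       : Carrier → Carrier → Carrier
    isMeetSemilattice : IsMeetSemilattice _≡_ _≤_ _∧_
    ⊥         : Carrier
    ⊥-minimum : ∀ x → ⊥ ≤ x
    interval        : Carrier → Carrier → List Carrier
    interval-unique : ∀ a b → Unique (interval a b)
    interval-spec   : ∀ a b y → (y ∈ interval a b) ⇔ (a ≤ y × y ≤ b)

  downL : Carrier → List Carrier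
  downL x = interval ⊥ x

  InL̃ : Carrier × Carrier → Set
  InL̃ (x , y) = (x ∧ y) ≡ ⊥

  _≤²_ : Carrier × Carrier → Carrier × Carrier → Set
  (z , t) ≤² (x , y) = (z ≤ x) × (t ≤ y)

module Submission where

-- For a Möbius function μ of a poset S, write δₐ for the indicator of a
-- point a.  Inverting δₐ gives a function fₐ (inverseOfδ a) with  Σ_{v≤c} fₐ(v) = δₐ(c);
-- conversely, by the forward direction of Möbius inversion, ANY function whose
-- zeta transform is δₐ takes the value μ(a,x) at every x ≥ a.
-- In L choose such fz and ft (for the points z and t), and consider
--   H(w₁,w₂) = fz(w₁) · ft(w₂)   on L̃.
-- Since L̃ is down-closed in L², the down-set of (x₁,x₂) in L̃ is the full
-- product [⊥,x₁] × [⊥,x₂], so the zeta transform of H on L̃ factorises as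
-- δz(x₁) · δt(x₂) = δ_(z,t)(x₁,x₂).  Applying the characterisation once in L̃
-- and twice in L gives  μ_L̃((z,t),(x,y)) = H(x,y) = μ_L(z,x) · μ_L(t,y).

open import Defs
open import Algebra.Bundles using (CommutativeMonoid)
open import Data.Integer using (ℤ; _*_; _+_; 0ℤ; 1ℤ)
open import Data.Integer.Properties
  using (+-0-commutativeMonoid; +-assoc; +-identityˡ; +-identityʳ;
         *-zeroˡ; *-zeroʳ; *-identityʳ; *-distribˡ-+; *-distribʳ-+)
open import Data.Product using (_×_; _,_; proj₁; proj₂)
open import Data.Product.Properties using (≡-dec)
open import Data.Unit using (⊤; tt)
open import Data.Empty using (⊥-elim)
open import Data.List using (List; []; _∷_; map; _++_; cartesianProduct)
open import Data.List.Membership.Propositional using (_∈_)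
open import Data.List.Membership.Propositional.Properties
  using (∈-cartesianProduct⁺; ∈-cartesianProduct⁻)
open import Data.List.Membership.Propositional.Properties.WithK using (unique∧set⇒bag)
open import Data.List.Relation.Unary.Any using (here; there)
open import Data.List.Relation.Unary.All as All using (All; []; _∷_)
open import Data.List.Relation.Unary.AllPairs using (_∷_)
open import Data.List.Relation.Unary.Unique.Propositional using (Unique)
open import Data.List.Relation.Unary.Unique.Propositional.Properties using (cartesianProduct⁺)
open import Data.List.Relation.Binary.Permutation.Propositional using (_↭_; ↭⇒↭ₛ)
open import Data.List.Relation.Binary.Permutation.Propositional.Properties using (map⁺)
open import Data.List.Relation.Binary.Permutation.Setoid.Properties using (foldr-commMonoid)
open import Data.List.Relation.Binary.BagAndSetEquality using (∼bag⇒↭)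
open import Function.Bundles using (_⇔_; mk⇔; Equivalence)
open import Relation.Nullary using (Dec; yes; no; ¬_)
open import Relation.Binary.Definitions using (DecidableEquality)
open import Relation.Binary.PropositionalEquality
  using (_≡_; _≢_; refl; sym; trans; cong; cong₂; subst; module ≡-Reasoning)
open import Relation.Binary.Lattice.Structures using (IsMeetSemilattice)

open Equivalence using (to; from)

Σ[_∈_] : {A : Set} → (A → ℤ) → List A → ℤ
Σ[ h ∈ l ] = sumℤ (map h l)

Σ-++ : {A : Set} (h : A → ℤ) (xs ys : List A) → Σ[ h ∈ xs ++ ys ] ≡ Σ[ h ∈ xs ] + Σ[ h ∈ ys ]
Σ-++ h []       ys = sym (+-identityˡ _)
Σ-++ h (x ∷ xs) ys = trans (cong (h x +_) (Σ-++ h xs ys)) (sym (+-assoc (h x) _ _))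

-- Sums do not depend on the order of the list; this lets us replace an
-- abstract enumeration of a finite set by a concrete one.
Σ-↭ : {A : Set} (h : A → ℤ) {xs ys : List A} → xs ↭ ys → Σ[ h ∈ xs ] ≡ Σ[ h ∈ ys ]
Σ-↭ h p = foldr-commMonoid ℤ+.setoid ℤ+.isCommutativeMonoid (↭⇒↭ₛ (map⁺ h p))
  where module ℤ+ = CommutativeMonoid +-0-commutativeMonoid

Σ-scale : {A : Set} (c : ℤ) (h : A → ℤ) (ys : List A) → Σ[ (λ y → c * h y) ∈ ys ] ≡ c * Σ[ h ∈ ys ]
Σ-scale c h []       = sym (*-zeroʳ c)
Σ-scale c h (y ∷ ys) = trans (cong (c * h y +_) (Σ-scale c h ys)) (sym (*-distribˡ-+ c (h y) _))

Σ-cartesianProduct : {A B : Set} (f : A → ℤ) (g : B → ℤ) (xs : List A) (ys : List B) →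
  Σ[ (λ w → f (proj₁ w) * g (proj₂ w)) ∈ cartesianProduct xs ys ] ≡ Σ[ f ∈ xs ] * Σ[ g ∈ ys ]
Σ-cartesianProduct f g []       ys = refl
Σ-cartesianProduct {A} {B} f g (x ∷ xs) ys = begin
  Σ[ fg ∈ map (x ,_) ys ++ cartesianProduct xs ys ]
    ≡⟨ Σ-++ fg (map (x ,_) ys) (cartesianProduct xs ys) ⟩
  Σ[ fg ∈ map (x ,_) ys ] + Σ[ fg ∈ cartesianProduct xs ys ]
    ≡⟨ cong₂ _+_ (trans (row ys) (Σ-scale (f x) g ys)) (Σ-cartesianProduct f g xs ys) ⟩
  f x * Σ[ g ∈ ys ] + Σ[ f ∈ xs ] * Σ[ g ∈ ys ]
    ≡⟨ sym (*-distribʳ-+ Σ[ g ∈ ys ] (f x) Σ[ f ∈ xs ]) ⟩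
  (f x + Σ[ f ∈ xs ]) * Σ[ g ∈ ys ] ∎
  where
  open ≡-Reasoning
  fg : A × B → ℤ
  fg w = f (proj₁ w) * g (proj₂ w)
  row : ∀ zs → Σ[ fg ∈ map (x ,_) zs ] ≡ Σ[ (λ y → f x * g y) ∈ zs ]
  row []       = refl
  row (z ∷ zs) = cong (f x * g z +_) (row zs)

Σ-zero : {A : Set} (h : A → ℤ) (l : List A) → All (λ w → h w ≡ 0ℤ) l → Σ[ h ∈ l ] ≡ 0ℤ
Σ-zero h []       []       = refl
Σ-zero h (x ∷ xs) (p ∷ ps) = cong₂ _+_ p (Σ-zero h xs ps)

module Indicator {X : Set} (_≟_ : DecidableEquality X) where

  δ : X → X → ℤ
  δ a w with w ≟ a
  ... | yes _ = 1ℤ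
  ... | no  _ = 0ℤ

  δ-self : ∀ a → δ a a ≡ 1ℤ
  δ-self a with a ≟ a
  ... | yes _  = refl
  ... | no a≢a = ⊥-elim (a≢a refl)

  δ-other : ∀ a w → w ≢ a → δ a w ≡ 0ℤ
  δ-other a w w≢a with w ≟ a
  ... | yes w≡a = ⊥-elim (w≢a w≡a)
  ... | no  _   = refl

  Σ-sift : (h : X → ℤ) (a : X) (l : List X) → Unique l → a ∈ l →
    Σ[ (λ w → h w * δ a w) ∈ l ] ≡ h a
  Σ-sift h a (x ∷ xs) (x∉xs ∷ _) (here refl) = begin
    h a * δ a a + Σ[ hδ ∈ xs ] ≡⟨ cong₂ _+_ (cong (h a *_) (δ-self a)) (Σ-zero hδ xs (All.map vanish x∉xs)) ⟩
    h a * 1ℤ + 0ℤ             ≡⟨ trans (+-identityʳ _) (*-identityʳ (h a)) ⟩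
    h a                        ∎
    where
    open ≡-Reasoning
    hδ : X → ℤ
    hδ w = h w * δ a w
    vanish : ∀ {w} → a ≢ w → hδ w ≡ 0ℤ
    vanish {w} a≢w = trans (cong (h w *_) (δ-other a w (λ w≡a → a≢w (sym w≡a)))) (*-zeroʳ (h w))
  Σ-sift h a (x ∷ xs) (x∉xs ∷ u) (there a∈xs) = begin
    h x * δ a x + Σ[ (λ w → h w * δ a w) ∈ xs ] ≡⟨ cong₂ _+_ x-vanishes (Σ-sift h a xs u a∈xs) ⟩
    0ℤ + h a                                     ≡⟨ +-identityˡ (h a) ⟩
    h a                                          ∎
    where
    open ≡-Reasoning
    x-vanishes : h x * δ a x ≡ 0ℤ
    x-vanishes = trans (cong (h x *_) (δ-other a x (λ x≡a → All.lookup x∉xs a∈xs x≡a))) (*-zeroʳ (h x))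

-- On a product, the indicator of a pair is the product of the indicators of
-- its components; this is what lets the zeta transform on L̃ factorise.
module IndicatorPair {X Y : Set} (_≟X_ : DecidableEquality X) (_≟Y_ : DecidableEquality Y) where
  private
    module δX  = Indicator _≟X_
    module δY  = Indicator _≟Y_
    module δXY = Indicator (≡-dec _≟X_ _≟Y_)

  δ-pair : ∀ a b w v → δXY.δ (a , b) (w , v) ≡ δX.δ a w * δY.δ b v
  δ-pair a b w v = byCases (w ≟X a) (v ≟Y b)
    where
    byCases : Dec (w ≡ a) → Dec (v ≡ b) → δXY.δ (a , b) (w , v) ≡ δX.δ a w * δY.δ b v
    byCases (yes refl) (yes refl) =
      trans (δXY.δ-self (a , b)) (sym (cong₂ _*_ (δX.δ-self a) (δY.δ-self b)))
    byCases (no w≢a) _ =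
      trans (δXY.δ-other (a , b) (w , v) (λ e → w≢a (cong proj₁ e)))
            (sym (trans (cong (_* δY.δ b v) (δX.δ-other a w w≢a)) (*-zeroˡ (δY.δ b v))))
    byCases (yes _) (no v≢b) =
      trans (δXY.δ-other (a , b) (w , v) (λ e → v≢b (cong proj₂ e)))
            (sym (trans (cong (δX.δ a w *_) (δY.δ-other b v v≢b)) (*-zeroʳ (δX.δ a w))))

module MobiusInversion {X : Set} (_≟_ : DecidableEquality X) (S : X → Set)
  (down : X → List X) (μ : X → X → ℤ) (isMobius : IsMobius S down μ) where
  open Indicator _≟_

  inverseOfδ : X → X → ℤ
  inverseOfδ a c = Σ[ (λ v → μ v c * δ a v) ∈ down c ]

  -- Its zeta transform is δₐ (the backward direction of Möbius inversion).
  inverseOfδ-zeta : ∀ a c → S c → δ a c ≡ Σ[ inverseOfδ a ∈ down c ]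
  inverseOfδ-zeta a = from (isMobius (inverseOfδ a) (δ a)) (λ _ _ → refl)

  -- Any function whose zeta transform is δₐ equals μ(a,-) above a (the
  -- forward direction of Möbius inversion, followed by sifting).
  zeta≡δ⇒mobius : (a : X) (f : X → ℤ) → (∀ c → S c → δ a c ≡ Σ[ f ∈ down c ]) →
    ∀ x → S x → Unique (down x) → a ∈ down x → f x ≡ μ a x
  zeta≡δ⇒mobius a f zeta x Sx unique a∈ =
    trans (to (isMobius f (δ a)) zeta x Sx) (Σ-sift (λ w → μ w x) a (down x) unique a∈)

module DisjointPairs (L : LFMeetSemilatticeWithBot) where
  open LFMeetSemilatticeWithBot L
  open IsMeetSemilattice isMeetSemilattice
    using (antisym; x∧y≤x; x∧y≤y; ∧-greatest) renaming (refl to ≤-refl; trans to ≤-trans)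

  -- Local finiteness makes the order decidable: a ≤ b iff [a,b] is nonempty.
  _≤?_ : ∀ a b → Dec (a ≤ b)
  a ≤? b with interval a b | interval-spec a b
  ... | []    | spec = no (λ a≤b → notInEmpty (from (spec a) (≤-refl , a≤b)))
    where
    notInEmpty : ¬ (a ∈ [])
    notInEmpty ()
  ... | y ∷ _ | spec = yes (≤-trans (proj₁ a≤y≤b) (proj₂ a≤y≤b))
    where
    a≤y≤b : a ≤ y × y ≤ b
    a≤y≤b = to (spec y) (here refl)

  _≟_ : DecidableEquality Carrier
  a ≟ b with a ≤? b | b ≤? a
  ... | yes a≤b | yes b≤a = yes (antisym a≤b b≤a)
  ... | no  a≰b | _       = no (λ a≡b → a≰b (subst (a ≤_) a≡b ≤-refl))
  ... | yes _   | no  b≰a = no (λ a≡b → b≰a (subst (_≤ a) a≡b ≤-refl))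

  ∈downL⇔≤ : ∀ a c → (a ∈ downL c) ⇔ (a ≤ c)
  ∈downL⇔≤ a c = mk⇔ (λ a∈ → proj₂ (to (interval-spec ⊥ c a) a∈))
                     (λ a≤c → from (interval-spec ⊥ c a) (⊥-minimum a , a≤c))

  L̃-downClosed : ∀ w₁ w₂ x₁ x₂ → InL̃ (x₁ , x₂) → w₁ ≤ x₁ → w₂ ≤ x₂ → InL̃ (w₁ , w₂)
  L̃-downClosed w₁ w₂ x₁ x₂ disjoint w₁≤x₁ w₂≤x₂ = antisym w₁∧w₂≤⊥ (⊥-minimum _)
    where
    w₁∧w₂≤⊥ : (w₁ ∧ w₂) ≤ ⊥
    w₁∧w₂≤⊥ = subst ((w₁ ∧ w₂) ≤_) disjoint
      (∧-greatest (≤-trans (x∧y≤x w₁ w₂) w₁≤x₁) (≤-trans (x∧y≤y w₁ w₂) w₂≤x₂))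

  module _ (D̃ : FinDownSets (Carrier × Carrier) InL̃ _≤²_) where
    open FinDownSets D̃

    -- Consequently the down-set of (x₁,x₂) in L̃ is the whole product
    -- [⊥,x₁] × [⊥,x₂]; as both enumerations are duplicate-free, they are
    -- permutations of each other.
    downL̃-↭-product : ∀ x₁ x₂ → InL̃ (x₁ , x₂) →
      down (x₁ , x₂) ↭ cartesianProduct (downL x₁) (downL x₂)
    downL̃-↭-product x₁ x₂ disjoint = ∼bag⇒↭ (unique∧set⇒bag
      (down-unique (x₁ , x₂))
      (cartesianProduct⁺ (interval-unique ⊥ x₁) (interval-unique ⊥ x₂))
      sameElements)
      where
      sameElements : ∀ {w} → (w ∈ down (x₁ , x₂)) ⇔ (w ∈ cartesianProduct (downL x₁) (downL x₂))
      sameElements {w₁ , w₂} = mk⇔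
        (λ w∈ → let (_ , w₁≤x₁ , w₂≤x₂) = to (down-spec (x₁ , x₂) disjoint (w₁ , w₂)) w∈ in
          ∈-cartesianProduct⁺ (from (∈downL⇔≤ w₁ x₁) w₁≤x₁) (from (∈downL⇔≤ w₂ x₂) w₂≤x₂))
        (λ w∈ → let (w₁∈ , w₂∈) = ∈-cartesianProduct⁻ (downL x₁) (downL x₂) w∈
                    w₁≤x₁ = to (∈downL⇔≤ w₁ x₁) w₁∈
                    w₂≤x₂ = to (∈downL⇔≤ w₂ x₂) w₂∈ in
          from (down-spec (x₁ , x₂) disjoint (w₁ , w₂))
            (L̃-downClosed w₁ w₂ x₁ x₂ disjoint w₁≤x₁ w₂≤x₂ , w₁≤x₁ , w₂≤x₂))

    Σ-downL̃ : (f g : Carrier → ℤ) → ∀ x₁ x₂ → InL̃ (x₁ , x₂) →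
      Σ[ (λ w → f (proj₁ w) * g (proj₂ w)) ∈ down (x₁ , x₂) ] ≡ Σ[ f ∈ downL x₁ ] * Σ[ g ∈ downL x₂ ]
    Σ-downL̃ f g x₁ x₂ disjoint =
      trans (Σ-↭ _ (downL̃-↭-product x₁ x₂ disjoint)) (Σ-cartesianProduct f g (downL x₁) (downL x₂))

mainTheorem2 : (L : LFMeetSemilatticeWithBot) →
    let open LFMeetSemilatticeWithBot L in
    (D̃ : FinDownSets (Carrier × Carrier) InL̃ _≤²_) →
    (μL : Carrier → Carrier → ℤ) → IsMobius (λ _ → ⊤) downL μL →
    (μL̃ : Carrier × Carrier → Carrier × Carrier → ℤ) →
    IsMobius InL̃ (FinDownSets.down D̃) μL̃ →
    ∀ z t x y → InL̃ (z , t) → InL̃ (x , y) → (z , t) ≤² (x , y) →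
    μL̃ (z , t) (x , y) ≡ μL z x * μL t y
mainTheorem2 L D̃ μL isMobiusL μL̃ isMobiusL̃ z t x y zt∈L̃ xy∈L̃ (z≤x , t≤y) = begin
  μL̃ (z , t) (x , y)  ≡⟨ sym (ML̃.zeta≡δ⇒mobius (z , t) h zeta-h (x , y) xy∈L̃ (down-unique (x , y)) zt∈down) ⟩
  h (x , y)           ≡⟨ cong₂ _*_ (inverse-is-mobius z x z≤x) (inverse-is-mobius t y t≤y) ⟩
  μL z x * μL t y     ∎
  where
  open ≡-Reasoning
  open LFMeetSemilatticeWithBot L
  open FinDownSets D̃
  open DisjointPairs L
  open Indicator _≟_
  module ML  = MobiusInversion _≟_ (λ _ → ⊤) downL μL isMobiusL
  module ML̃ = MobiusInversion (≡-dec _≟_ _≟_) InL̃ down μL̃ isMobiusL̃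

  inverse-is-mobius : ∀ a c → a ≤ c → ML.inverseOfδ a c ≡ μL a c
  inverse-is-mobius a c a≤c = ML.zeta≡δ⇒mobius a (ML.inverseOfδ a) (ML.inverseOfδ-zeta a)
    c tt (interval-unique ⊥ c) (from (∈downL⇔≤ a c) a≤c)

  h : Carrier × Carrier → ℤ
  h (w₁ , w₂) = ML.inverseOfδ z w₁ * ML.inverseOfδ t w₂

  zeta-h : ∀ X → InL̃ X → Indicator.δ (≡-dec _≟_ _≟_) (z , t) X ≡ Σ[ h ∈ down X ]
  zeta-h (x₁ , x₂) disjoint = begin
    Indicator.δ (≡-dec _≟_ _≟_) (z , t) (x₁ , x₂)
      ≡⟨ IndicatorPair.δ-pair _≟_ _≟_ z t x₁ x₂ ⟩
    δ z x₁ * δ t x₂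
      ≡⟨ cong₂ _*_ (ML.inverseOfδ-zeta z x₁ tt) (ML.inverseOfδ-zeta t x₂ tt) ⟩
    Σ[ ML.inverseOfδ z ∈ downL x₁ ] * Σ[ ML.inverseOfδ t ∈ downL x₂ ]
      ≡⟨ sym (Σ-downL̃ D̃ (ML.inverseOfδ z) (ML.inverseOfδ t) x₁ x₂ disjoint) ⟩
    Σ[ h ∈ down (x₁ , x₂) ] ∎

  zt∈down : (z , t) ∈ down (x , y)
  zt∈down = from (down-spec (x , y) xy∈L̃ (z , t)) (zt∈L̃ , z≤x , t≤y)
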